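{- Let $n\in\mathbb{N}$ and let $\alpha$ be a unit-interval parking function of length $n$. Then $\alpha$ is prime if and only if $\alpha=(1,1,2,3,\dots,n-1)$.
   Context: A parking function of length $n$ is $\alpha=(a_1,\dots,a_n)\in[n]^n$ such that, when cars $1,\dots,n$ arrive in order on a one-way street with spots $1,\dots,n$ and car $i$ parks in the first unoccupied spot $\ge a_i$, every car parks. If car $i$ parks in spot $s_i$, its displacement is $s_i-a_i$. A unit-interval parking function is a parking function in which every car has displacement at most $1$. A parking function $\alpha$ has a breakpoint at $k$ if $|\{i: a_i\le k\}|=k$; it is prime if its only breakpoint is at $n$. (For $n=1$ the tuple $(1,1,2,\dots,n-1)$ is read as $(1)$.) -}

module Defs where

open import Data.Nat using (ℕ; zero; suc; _∸_; _≤_; _≤?_)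
open import Data.Nat.Properties using (_≟_)
open import Data.Fin using (toℕ)
open import Data.List using (List; []; _∷_; length; filter; zipWith)
open import Data.List.Relation.Unary.All using (All)
open import Data.List.Relation.Unary.Any using (any?)
open import Data.Maybe using (Maybe; just; nothing)
import Data.Maybe as Maybe
open import Data.Vec using (Vec; toList; tabulate; []; _∷_)
open import Data.Product using (Σ; _×_; ∃)
open import Relation.Binary.PropositionalEquality using (_≡_)
open import Relation.Nullary using (yes; no)

search : ℕ → List ℕ → ℕ → Maybe ℕ
search zero occ s = nothing
search (suc fuel) occ s with any? (s ≟_) occ
... | yes _ = search fuel occ (suc s)
... | no _  = just s

-- Car with preference a checks
-- spots a, a+1, ..., n.
park : ℕ → List ℕ → List ℕ → Maybe (List ℕ)
park n occ [] = just []
park n occ (a ∷ as) with search (suc n ∸ a) occ a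
... | nothing = nothing
... | just s  = Maybe.map (s ∷_) (park n (s ∷ occ) as)

InRange : (n : ℕ) → ℕ → Set
InRange n a = 1 ≤ a × a ≤ n

ParksAs : (n : ℕ) → Vec ℕ n → List ℕ → Set
ParksAs n α spots = All (InRange n) (toList α) × park n [] (toList α) ≡ just spots

IsParkingFunction : (n : ℕ) → Vec ℕ n → Set
IsParkingFunction n α = ∃ λ spots → ParksAs n α spots

IsUnitIntervalPF : (n : ℕ) → Vec ℕ n → Set
IsUnitIntervalPF n α =
  ∃ λ spots → ParksAs n α spots × All (_≤ 1) (zipWith _∸_ spots (toList α))

countLe : {n : ℕ} → ℕ → Vec ℕ n → ℕ
countLe k α = length (filter (_≤? k) (toList α))

Breakpoint : {n : ℕ} → Vec ℕ n → ℕ → Set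
Breakpoint α k = countLe k α ≡ k

IsPrime : (n : ℕ) → Vec ℕ n → Set
IsPrime n α = (Breakpoint α n) × (∀ k → 1 ≤ k → k ≤ n → Breakpoint α k → k ≡ n)

target : (n : ℕ) → Vec ℕ n
target zero = []
target (suc m) = 1 ∷ tabulate (λ i → suc (toℕ i))

-- While α agrees with (1, 1, 2, …), after t cars
-- the block 1..t is full.  The next car has displacement ≤ 1, so if it prefers a spot ≤ t
-- it must prefer t and park at t + 1.  If instead it prefers k + 1 > t, it parks there;
-- no later car can then cross the occupied spot k + 1, and the free spots all get filled,
-- so the spots ≤ k go to exactly the cars preferring a spot ≤ k: a breakpoint at k < n.
-- Conversely, for 1 ≤ k < n exactly k + 1 entries of (1, 1, 2, …, n - 1) are ≤ k.
module Submission where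

open import Defs
open import Data.Nat using (ℕ; zero; suc; _+_; _∸_; _⊓_; _≤_; _<_; _≤?_; z≤n; s≤s; s≤s⁻¹; z<s)
open import Data.Nat.Properties
open import Data.List using (List; []; _∷_; length; filter; zipWith; iterate; applyDownFrom)
open import Data.List.Properties using (filter-accept; filter-reject; filter-all)
open import Data.List.Membership.Propositional using (_∉_)
open import Data.List.Membership.Propositional.Properties using (∈-applyDownFrom⁺; ∈-applyDownFrom⁻)
open import Data.List.Relation.Unary.All as All using (All; []; _∷_)
open import Data.List.Relation.Unary.All.Properties using (all-filter) renaming (filter⁺ to All-filter⁺)
open import Data.List.Relation.Unary.Any using (here; there; any?)
open import Data.List.Relation.Unary.AllPairs using ([]; _∷_)
open import Data.List.Relation.Unary.Unique.Propositional using (Unique)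
open import Data.List.Relation.Unary.Unique.Propositional.Properties using () renaming (filter⁺ to Unique-filter⁺)
open import Data.List.Relation.Binary.Pointwise using (Pointwise; []; _∷_; Pointwise-length)
open import Data.Vec using (Vec; toList; tabulate)
open import Data.Vec.Properties using (toList-injective; tabulate-cong; length-toList)
open import Data.Vec.Relation.Binary.Equality.Cast using (cast-is-id)
open import Data.Fin using (toℕ)
open import Data.Maybe using (just; nothing)
open import Data.Product using (∃; _×_; _,_; proj₁; proj₂)
open import Data.Sum using (inj₁; inj₂)
open import Function using (_∘_)
open import Function.Bundles using (_⇔_; mk⇔)
open import Relation.Binary.PropositionalEquality
open import Relation.Nullary using (yes; no; ¬_; contradiction)
open import Relation.Unary using (Pred; Decidable)
open import Relation.Unary.Properties using (∁?)

count≤ : ℕ → List ℕ → ℕ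
count≤ k xs = length (filter (_≤? k) xs)

count≤-∷-≤ : ∀ {k x} xs → x ≤ k → count≤ k (x ∷ xs) ≡ suc (count≤ k xs)
count≤-∷-≤ _ x≤k = cong length (filter-accept (_≤? _) x≤k)

count≤-∷-≰ : ∀ {k x} xs → ¬ x ≤ k → count≤ k (x ∷ xs) ≡ count≤ k xs
count≤-∷-≰ _ x≰k = cong length (filter-reject (_≤? _) x≰k)

module _ {a p} {A : Set a} {P : Pred A p} (P? : Decidable P) where

  length-filter+length-filter-∁ : ∀ xs →
    length (filter P? xs) + length (filter (∁? P?) xs) ≡ length xs
  length-filter+length-filter-∁ [] = refl
  length-filter+length-filter-∁ (x ∷ xs) with P? x
  ... | yes _ = cong suc (length-filter+length-filter-∁ xs)
  ... | no _  = trans (+-suc _ _) (cong suc (length-filter+length-filter-∁ xs))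

  All-filter⁺-∩ : ∀ {q} {Q : Pred A q} {xs} → All Q xs → All (λ x → Q x × P x) (filter P? xs)
  All-filter⁺-∩ {xs = xs} qs = All.zip (All-filter⁺ P? qs , all-filter P? xs)

InInterval : ℕ → ℕ → ℕ → Set
InInterval lo hi x = lo < x × x ≤ hi

length≤1+count≤ : ∀ h {xs} → Unique xs → All (_≤ suc h) xs → length xs ≤ suc (count≤ h xs)
length≤1+count≤ h {[]} _ _ = z≤n
length≤1+count≤ h {x ∷ xs} (x≢xs ∷ unique) (x≤1+h ∷ bounded) with x ≤? h
... | yes x≤h = begin
  suc (length xs)           ≤⟨ s≤s (length≤1+count≤ h unique bounded) ⟩
  suc (suc (count≤ h xs))   ≡⟨ cong suc (count≤-∷-≤ xs x≤h) ⟨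
  suc (count≤ h (x ∷ xs))   ∎
  where open ≤-Reasoning
... | no x≰h = begin
  suc (length xs)           ≡⟨ cong (suc ∘ length) (filter-all (_≤? h) xs≤h) ⟨
  suc (count≤ h xs)         ≡⟨ cong suc (count≤-∷-≰ xs x≰h) ⟨
  suc (count≤ h (x ∷ xs))   ∎
  where
  open ≤-Reasoning
  below : ∀ {y} → x ≢ y × y ≤ suc h → y ≤ h
  below (x≢y , y≤1+h) =
    s≤s⁻¹ (≤∧≢⇒< y≤1+h (λ y≡1+h → x≢y (trans (≤-antisym x≤1+h (≰⇒> x≰h)) (sym y≡1+h))))
  xs≤h : All (_≤ h) xs
  xs≤h = All.zipWith below (x≢xs , bounded)

length-unique-in-interval : ∀ lo hi {xs} → Unique xs → All (InInterval lo hi) xs →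
                            length xs ≤ hi ∸ lo
length-unique-in-interval lo hi {[]} _ _ = z≤n
length-unique-in-interval lo zero {x ∷ _} _ ((lo<x , x≤0) ∷ _) =
  contradiction (≤-trans lo<x x≤0) λ ()
length-unique-in-interval lo (suc h) {xs@(_ ∷ _)} unique inside@((lo<x , x≤1+h) ∷ _) = begin
  length xs          ≤⟨ length≤1+count≤ h unique (All.map proj₂ inside) ⟩
  suc (count≤ h xs)  ≤⟨ s≤s (length-unique-in-interval lo h (Unique-filter⁺ (_≤? h) unique)
                              (All.map (λ ((lo<y , _) , y≤h) → lo<y , y≤h) (All-filter⁺-∩ (_≤? h) inside))) ⟩
  suc (h ∸ lo)       ≡⟨ +-∸-assoc 1 (s≤s⁻¹ (≤-trans lo<x x≤1+h)) ⟨
  suc h ∸ lo         ∎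
  where open ≤-Reasoning

-- Pigeonhole: |S| = n ∸ t distinct spots in (t, n] fill that interval.
count≤-filling : ∀ {t n k S} → Unique S → All (InInterval t n) S → t + length S ≡ n →
                 t ≤ k → k ≤ n → count≤ k S ≡ k ∸ t
count≤-filling {t} {n} {k} {S} unique inside fills t≤k k≤n =
  squeeze below above (trans (length-filter+length-filter-∁ (_≤? k) S) length≡)
  where
  below : count≤ k S ≤ k ∸ t
  below = length-unique-in-interval t k (Unique-filter⁺ (_≤? k) unique)
            (All.map (λ ((t<x , _) , x≤k) → t<x , x≤k) (All-filter⁺-∩ (_≤? k) inside))
  above : length (filter (∁? (_≤? k)) S) ≤ n ∸ k
  above = length-unique-in-interval k n (Unique-filter⁺ (∁? (_≤? k)) unique)
            (All.map (λ ((_ , x≤n) , x≰k) → ≰⇒> x≰k , x≤n) (All-filter⁺-∩ (∁? (_≤? k)) inside))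
  length≡ : length S ≡ (k ∸ t) + (n ∸ k)
  length≡ = +-cancelˡ-≡ t _ _ (begin
    t + length S               ≡⟨ fills ⟩
    n                          ≡⟨ m+[n∸m]≡n k≤n ⟨
    k + (n ∸ k)                ≡⟨ cong (_+ (n ∸ k)) (m+[n∸m]≡n t≤k) ⟨
    t + (k ∸ t) + (n ∸ k)      ≡⟨ +-assoc t _ _ ⟩
    t + ((k ∸ t) + (n ∸ k))    ∎)
    where open ≡-Reasoning
  squeeze : ∀ {a b c d} → a ≤ c → b ≤ d → a + b ≡ c + d → a ≡ c
  squeeze {a} {b} {c} {d} a≤c b≤d eq =
    ≤-antisym a≤c (+-cancelʳ-≤ d c a (≤-trans (≤-reflexive (sym eq)) (+-monoʳ-≤ a b≤d)))

count≤-iterate : ∀ k t m → count≤ k (iterate suc t m) ≡ m ⊓ (suc k ∸ t)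
count≤-iterate k t zero = refl
count≤-iterate k t (suc m) with t ≤? k
... | yes t≤k = begin
  count≤ k (t ∷ iterate suc (suc t) m)    ≡⟨ count≤-∷-≤ _ t≤k ⟩
  suc (count≤ k (iterate suc (suc t) m))  ≡⟨ cong suc (count≤-iterate k (suc t) m) ⟩
  suc (m ⊓ (k ∸ t))                       ≡⟨ cong (suc m ⊓_) (+-∸-assoc 1 t≤k) ⟨
  suc m ⊓ (suc k ∸ t)                     ∎
  where open ≡-Reasoning
... | no t≰k = begin
  count≤ k (t ∷ iterate suc (suc t) m)    ≡⟨ count≤-∷-≰ _ t≰k ⟩
  count≤ k (iterate suc (suc t) m)        ≡⟨ count≤-iterate k (suc t) m ⟩
  m ⊓ (k ∸ t)                             ≡⟨ cong (m ⊓_) (m≤n⇒m∸n≡0 (<⇒≤ (≰⇒> t≰k))) ⟩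
  m ⊓ 0                                   ≡⟨ ⊓-zeroʳ m ⟩
  0                                       ≡⟨ cong (suc m ⊓_) (m≤n⇒m∸n≡0 (≰⇒> t≰k)) ⟨
  suc m ⊓ (suc k ∸ t)                     ∎
  where open ≡-Reasoning

toList-tabulate-+ : ∀ t m → toList (tabulate {n = m} (λ i → t + toℕ i)) ≡ iterate suc t m
toList-tabulate-+ t zero = refl
toList-tabulate-+ t (suc m) = cong₂ _∷_ (+-identityʳ t)
  (trans (cong toList (tabulate-cong (λ i → +-suc t (toℕ i)))) (toList-tabulate-+ (suc t) m))

toList-target : ∀ m → toList (target (suc m)) ≡ 1 ∷ iterate suc 1 m
toList-target m = cong (1 ∷_) (toList-tabulate-+ 1 m)

count≤-target : ∀ m k → count≤ (suc k) (toList (target (suc m))) ≡ suc (m ⊓ suc k)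
count≤-target m k = begin
  count≤ (suc k) (toList (target (suc m)))  ≡⟨ cong (count≤ (suc k)) (toList-target m) ⟩
  count≤ (suc k) (1 ∷ iterate suc 1 m)      ≡⟨ count≤-∷-≤ {suc k} (iterate suc 1 m) (s≤s z≤n) ⟩
  suc (count≤ (suc k) (iterate suc 1 m))    ≡⟨ cong suc (count≤-iterate (suc k) 1 m) ⟩
  suc (m ⊓ suc k)                           ∎
  where open ≡-Reasoning

target-isPrime : ∀ m → IsPrime (suc m) (target (suc m))
target-isPrime m = trans (count≤-target m m) (cong suc (m≤n⇒m⊓n≡m (n≤1+n m))) , onlyAtEnd
  where
  onlyAtEnd : ∀ k → 1 ≤ k → k ≤ suc m → Breakpoint (target (suc m)) k → k ≡ suc m
  onlyAtEnd (suc k) _ _ bp with suc-injective (trans (sym (count≤-target m k)) bp) | ≤-total m (suc k)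
  ... | m⊓1+k≡k | inj₁ m≤1+k = cong suc (trans (sym m⊓1+k≡k) (m≤n⇒m⊓n≡m m≤1+k))
  ... | m⊓1+k≡k | inj₂ 1+k≤m = contradiction (trans (sym (m≥n⇒m⊓n≡n 1+k≤m)) m⊓1+k≡k) 1+n≢n

toList-injective-≡ : ∀ {a} {A : Set a} {m} {xs ys : Vec A m} → toList xs ≡ toList ys → xs ≡ ys
toList-injective-≡ {xs = xs} {ys} eq =
  trans (sym (cast-is-id refl xs)) (toList-injective refl xs ys eq)

search-sound : ∀ f occ x {s} → search f occ x ≡ just s → x ≤ s × s < x + f × s ∉ occ
search-sound zero occ x ()
search-sound (suc f) occ x eq with any? (x ≟_) occ
... | yes _ with 1+x≤s , s<1+x+f , s∉occ ← search-sound f occ (suc x) eq =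
  <⇒≤ 1+x≤s , ≤-trans s<1+x+f (≤-reflexive (sym (+-suc x f))) , s∉occ
... | no x∉occ with refl ← eq = ≤-refl , m<m+n x z<s , x∉occ

search-first : ∀ f occ x {s} → x ∉ occ → search f occ x ≡ just s → s ≡ x
search-first zero occ x _ ()
search-first (suc f) occ x x∉occ eq with any? (x ≟_) occ
... | yes x∈occ = contradiction x∈occ x∉occ
... | no _ with refl ← eq = refl

a≤s<a+[1+n∸a]⇒s≤n : ∀ {a s} n → a ≤ s → s < a + (suc n ∸ a) → s ≤ n
a≤s<a+[1+n∸a]⇒s≤n {a} n a≤s s<bound with a ≤? suc n
... | yes a≤1+n = s≤s⁻¹ (≤-trans s<bound (≤-reflexive (m+[n∸m]≡n a≤1+n)))
... | no a≰1+n = contradiction a≤s (<⇒≱ (≤-trans s<bound (≤-reflexive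
                   (trans (cong (a +_) (m≤n⇒m∸n≡0 (<⇒≤ (≰⇒> a≰1+n)))) (+-identityʳ a)))))

park-∷⁻ : ∀ n occ a R {S} → park n occ (a ∷ R) ≡ just S →
  ∃ λ s → ∃ λ S′ → S ≡ s ∷ S′ × search (suc n ∸ a) occ a ≡ just s × park n (s ∷ occ) R ≡ just S′
park-∷⁻ n occ a R eq with search (suc n ∸ a) occ a in search≡
park-∷⁻ n occ a R () | nothing
... | just s with park n (s ∷ occ) R in park≡
park-∷⁻ n occ a R () | just s | nothing
park-∷⁻ n occ a R refl | just s | just S′ = s , S′ , refl , refl , park≡

-- IsUnitIntervalPF generalised to a street whose spots occ are already taken.
record UnitIntervalRun (n : ℕ) (occ prefs : List ℕ) : Set where
  field
    spots   : List ℕ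
    inRange : All (InRange n) prefs
    parks   : park n occ prefs ≡ just spots
    unit    : All (_≤ 1) (zipWith _∸_ spots prefs)

open UnitIntervalRun using (inRange)

UnitIntervalRun-∷⁻ : ∀ {n occ a R} → UnitIntervalRun n occ (a ∷ R) →
  ∃ λ s → search (suc n ∸ a) occ a ≡ just s × s ≤ suc a × UnitIntervalRun n (s ∷ occ) R
UnitIntervalRun-∷⁻ {n} {occ} {a} {R} record { inRange = _ ∷ inRange ; parks = parks ; unit = unit }
  with s , S′ , refl , search≡ , parks′ ← park-∷⁻ n occ a R parks
  with s∸a≤1 ∷ unit′ ← unit =
  s , search≡ , s≤1+a , record { spots = S′ ; inRange = inRange ; parks = parks′ ; unit = unit′ }
  where
  s≤1+a : s ≤ suc a
  s≤1+a = ≤-trans (m≤n+m∸n s a) (≤-trans (+-monoʳ-≤ a s∸a≤1) (≤-reflexive (+-comm a 1)))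

UnitStep : ℕ → ℕ → Set
UnitStep a s = a ≤ s × s ≤ suc a

UnitIntervalRun⇒placement : ∀ {n occ R} → UnitIntervalRun n occ R →
  ∃ λ S → Pointwise UnitStep R S × All (InRange n) S × Unique S × All (_∉ occ) S
UnitIntervalRun⇒placement {R = []} _ = [] , [] , [] , [] , []
UnitIntervalRun⇒placement {n} {occ} {a ∷ R} run
  with s , search≡ , s≤1+a , tail ← UnitIntervalRun-∷⁻ run
  with a≤s , s<bound , s∉occ ← search-sound _ occ a search≡
  with S , steps , inRangeS , unique , free ← UnitIntervalRun⇒placement tail =
  s ∷ S ,
  (a≤s , s≤1+a) ∷ steps ,
  (≤-trans (proj₁ (All.head (inRange run))) a≤s , a≤s<a+[1+n∸a]⇒s≤n n a≤s s<bound) ∷ inRangeS ,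
  All.map (λ y∉ s≡y → y∉ (here (sym s≡y))) free ∷ unique ,
  s∉occ ∷ All.map (λ y∉ → y∉ ∘ there) free

occupied : ℕ → List ℕ
occupied t = applyDownFrom suc t

∉occupied⇒> : ∀ {t x} → 1 ≤ x → x ∉ occupied t → t < x
∉occupied⇒> {x = suc i} _ x∉ = ≰⇒> (λ i<t → x∉ (∈-applyDownFrom⁺ suc i<t))

>⇒∉occupied : ∀ {t x} → t < x → x ∉ occupied t
>⇒∉occupied t<x x∈ with _ , i<t , refl ← ∈-applyDownFrom⁻ suc x∈ = <⇒≱ t<x i<t

count≤-unit-steps : ∀ {k R S} → Pointwise UnitStep R S → All (_≢ suc k) S →
                    count≤ k R ≡ count≤ k S
count≤-unit-steps [] [] = refl
count≤-unit-steps {k} {x ∷ R} {y ∷ S} ((x≤y , y≤1+x) ∷ steps) (y≢1+k ∷ avoid) with y ≤? k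
... | yes y≤k = begin
  count≤ k (x ∷ R)  ≡⟨ count≤-∷-≤ R (≤-trans x≤y y≤k) ⟩
  suc (count≤ k R)  ≡⟨ cong suc (count≤-unit-steps steps avoid) ⟩
  suc (count≤ k S)  ≡⟨ count≤-∷-≤ S y≤k ⟨
  count≤ k (y ∷ S)  ∎
  where open ≡-Reasoning
... | no y≰k = begin
  count≤ k (x ∷ R)  ≡⟨ count≤-∷-≰ R x≰k ⟩
  count≤ k R        ≡⟨ count≤-unit-steps steps avoid ⟩
  count≤ k S        ≡⟨ count≤-∷-≰ S y≰k ⟨
  count≤ k (y ∷ S)  ∎
  where
  open ≡-Reasoning
  x≰k : ¬ x ≤ k
  x≰k x≤k = y≰k (s≤s⁻¹ (≤∧≢⇒< (≤-trans y≤1+x (s≤s x≤k)) y≢1+k))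

jump⇒breakpoint : ∀ {n t k R} → t ≤ k → t + length (suc k ∷ R) ≡ n →
  UnitIntervalRun n (occupied t) (suc k ∷ R) → count≤ k (suc k ∷ R) ≡ k ∸ t
jump⇒breakpoint {n} {t} {k} {R} t≤k fills run
  with s , search≡ , _ , tail ← UnitIntervalRun-∷⁻ run
  with refl ← search-first (suc n ∸ suc k) (occupied t) (suc k) (>⇒∉occupied (s≤s t≤k)) search≡
  with S , steps , inRangeS , unique , free ← UnitIntervalRun⇒placement tail = begin
    count≤ k (suc k ∷ R)  ≡⟨ count≤-∷-≰ R 1+n≰n ⟩
    count≤ k R            ≡⟨ count≤-unit-steps steps (All.map (λ y∉ → y∉ ∘ here) free) ⟩
    count≤ k S            ≡⟨ count≤-∷-≰ S 1+n≰n ⟨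
    count≤ k (suc k ∷ S)  ≡⟨ count≤-filling unique′ inside fills′ t≤k (<⇒≤ 1+k≤n) ⟩
    k ∸ t                 ∎
  where
  open ≡-Reasoning
  1+k≤n : suc k ≤ n
  1+k≤n = proj₂ (All.head (inRange run))
  unique′ : Unique (suc k ∷ S)
  unique′ = All.map (λ y∉ 1+k≡y → y∉ (here (sym 1+k≡y))) free ∷ unique
  inside : All (InInterval t n) (suc k ∷ S)
  inside = (s≤s t≤k , 1+k≤n) ∷
    All.zipWith (λ ((1≤y , y≤n) , y∉) → ∉occupied⇒> 1≤y (y∉ ∘ there) , y≤n) (inRangeS , free)
  fills′ : t + length (suc k ∷ S) ≡ n
  fills′ = trans (cong (λ l → t + suc l) (sym (Pointwise-length steps))) fills

noBreakpoint⇒ascending : ∀ {n t R} → t + length R ≡ n → UnitIntervalRun n (occupied t) R →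
  (∀ k → t ≤ k → k < n → count≤ k R ≢ k ∸ t) → R ≡ iterate suc t (length R)
noBreakpoint⇒ascending {R = []} _ _ _ = refl
noBreakpoint⇒ascending {n} {t} {a ∷ R} fills run noBreakpoint with a ≤? t
... | no a≰t with ≰⇒> a≰t
...   | s≤s t≤k = contradiction (jump⇒breakpoint t≤k fills run)
                    (noBreakpoint _ t≤k (proj₂ (All.head (inRange run))))
noBreakpoint⇒ascending {n} {t} {a ∷ R} fills run noBreakpoint | yes a≤t
  with s , search≡ , s≤1+a , tail ← UnitIntervalRun-∷⁻ run
  with a≤s , _ , s∉occ ← search-sound (suc n ∸ a) (occupied t) a search≡
  with t<s ← ∉occupied⇒> (≤-trans (proj₁ (All.head (inRange run))) a≤s) s∉occ
  with refl ← ≤-antisym (≤-trans s≤1+a (s≤s a≤t)) t<s =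
  cong₂ _∷_ a≡t (noBreakpoint⇒ascending (trans (sym (+-suc t (length R))) fills) tail noBreakpoint′)
  where
  a≡t : a ≡ t
  a≡t = ≤-antisym a≤t (s≤s⁻¹ s≤1+a)
  noBreakpoint′ : ∀ j → suc t ≤ j → j < n → count≤ j R ≢ j ∸ suc t
  noBreakpoint′ j 1+t≤j j<n bp = noBreakpoint j (<⇒≤ 1+t≤j) j<n (begin
    count≤ j (a ∷ R)    ≡⟨ count≤-∷-≤ R (≤-trans a≤t (<⇒≤ 1+t≤j)) ⟩
    suc (count≤ j R)    ≡⟨ cong suc bp ⟩
    suc (j ∸ suc t)     ≡⟨ +-∸-assoc 1 1+t≤j ⟨
    j ∸ t               ∎)
    where open ≡-Reasoning

-- On the empty street every first car is a jump; preferring 1 yields only the trivial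
-- breakpoint 0, which primality does not exclude.
prime⇒ascending : ∀ {m R} → length R ≡ suc m → UnitIntervalRun (suc m) [] R →
  (∀ k → 1 ≤ k → k ≤ suc m → count≤ k R ≡ k → k ≡ suc m) → R ≡ 1 ∷ iterate suc 1 m
prime⇒ascending {R = zero ∷ _} _ record { inRange = (() , _) ∷ _ } _
prime⇒ascending {m} {suc (suc k) ∷ R} len run onlyAtEnd =
  contradiction (onlyAtEnd (suc k) (s≤s z≤n) (<⇒≤ 2+k≤1+m) (jump⇒breakpoint z≤n len run))
                (<⇒≢ 2+k≤1+m)
  where
  2+k≤1+m : suc (suc k) ≤ suc m
  2+k≤1+m = proj₂ (All.head (inRange run))
prime⇒ascending {m} {1 ∷ R} len run onlyAtEnd
  with s , search≡ , _ , tail ← UnitIntervalRun-∷⁻ run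
  with refl ← search-first (suc m) [] 1 (λ ()) search≡ =
  cong (1 ∷_) (trans (noBreakpoint⇒ascending len tail noBreakpoint)
                     (cong (iterate suc 1) (suc-injective len)))
  where
  noBreakpoint : ∀ k → 1 ≤ k → k < suc m → count≤ k R ≢ k ∸ 1
  noBreakpoint (suc j) _ j<1+m bp =
    <⇒≢ j<1+m (onlyAtEnd (suc j) (s≤s z≤n) (<⇒≤ j<1+m)
      (trans (count≤-∷-≤ R (s≤s z≤n)) (cong suc bp)))

lemma2p4 : (n : ℕ) → 1 ≤ n → (α : Vec ℕ n) → IsUnitIntervalPF n α →
           IsPrime n α ⇔ (α ≡ target n)
lemma2p4 (suc m) _ α (spots , (inRange , parks) , unit) = mk⇔ prime⇒target target⇒prime
  where
  run : UnitIntervalRun (suc m) [] (toList α)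
  run = record { spots = spots ; inRange = inRange ; parks = parks ; unit = unit }
  prime⇒target : IsPrime (suc m) α → α ≡ target (suc m)
  prime⇒target (_ , onlyAtEnd) =
    toList-injective-≡ (trans (prime⇒ascending (length-toList α) run onlyAtEnd)
                              (sym (toList-target m)))
  target⇒prime : α ≡ target (suc m) → IsPrime (suc m) α
  target⇒prime refl = target-isPrime m
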